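{- For all formulas $\phi,\chi$: $\phi\vDash_{\mathrm{ETL}_{\mathbf{M}\omega}}\chi$ if and only if there is a tableaux proof of $\phi\vdash_{\mathrm{ETL}_{\mathbf{M}\omega}}\chi$ (in the calculus for $\mathbf{M}\omega$ described in the context).
   Context: Semantics: $\mathbf{M}\omega$ is the lattice consisting of a top $\top$, a bottom $\bot$, and countably infinitely many pairwise incomparable middle elements $\mathbf{1},\mathbf{2},\ldots,\mathbf{n},\ldots$. Formulas are built from propositional variables using $\neg,\wedge,\vee$; a valuation maps variables to $\mathbf{M}\omega$ and is extended by interpreting $\wedge,\vee$ as meet and join and $\neg$ by $\neg\top=\bot$, $\neg\bot=\top$, $\neg x=x$ for each middle element $x$. $\phi\vDash_{\mathrm{ETL}_{\mathbf{M}\omega}}\chi$ iff for every valuation $v$, $v(\phi)=\top$ implies $v(\chi)=\top$. Tableaux: a tableau is a downward branching tree whose nodes contain labelled formulas $\mathfrak{t}[\phi]$, $\mathfrak{m}[\phi]$, $\mathfrak{f}[\phi]$ and labelled pairs $\phi\sim\chi$, $\phi\nsim\chi$; branches are regarded as sets. A branch containing the premise(s) of a rule may be extended by the rule; conclusions separated by $\mid$ split the branch. Rules ($i\in\{1,2\}$, $p,q,r$ propositional variables, $\circ\in\{\wedge,\vee\}$): $(\mathfrak{t}\wedge)$: $\mathfrak{t}[\phi\wedge\chi]$ / $\mathfrak{t}[\phi],\mathfrak{t}[\chi]$. $(\mathfrak{t}\vee)$: $\mathfrak{t}[\phi\vee\chi]$ / $\mathfrak{t}[\phi]\mid\mathfrak{t}[\chi]\mid\mathfrak{m}[\phi],\mathfrak{m}[\chi],\phi\nsim\chi$.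 $(\mathfrak{t}\neg)$: $\mathfrak{t}[\neg\phi]$ / $\mathfrak{f}[\phi]$. $(\mathfrak{m}\wedge)$: $\mathfrak{m}[\phi\wedge\chi]$ / $\mathfrak{t}[\phi],\mathfrak{m}[\chi]\mid\mathfrak{m}[\phi],\mathfrak{t}[\chi]\mid\mathfrak{m}[\phi],\mathfrak{m}[\chi],\phi\sim\chi$. $(\mathfrak{m}\vee)$: $\mathfrak{m}[\phi\vee\chi]$ / $\mathfrak{f}[\phi],\mathfrak{m}[\chi]\mid\mathfrak{m}[\phi],\mathfrak{f}[\chi]\mid\mathfrak{m}[\phi],\mathfrak{m}[\chi],\phi\sim\chi$. $(\mathfrak{m}\neg)$: $\mathfrak{m}[\neg\phi]$ / $\mathfrak{m}[\phi],\phi\sim\neg\phi$. $(\mathfrak{f}\wedge)$: $\mathfrak{f}[\phi\wedge\chi]$ / $\mathfrak{f}[\phi]\mid\mathfrak{f}[\chi]\mid\mathfrak{m}[\phi],\mathfrak{m}[\chi],\phi\nsim\chi$. $(\mathfrak{f}\vee)$: $\mathfrak{f}[\phi\vee\chi]$ / $\mathfrak{f}[\phi],\mathfrak{f}[\chi]$. $(\mathfrak{f}\neg)$: $\mathfrak{f}[\neg\phi]$ / $\mathfrak{t}[\phi]$. $(\sim\mathsf{sym})$: $\phi\sim\chi$ / $\chi\sim\phi$; $(\nsim\mathsf{sym})$: $\phi\nsim\chi$ / $\chi\nsim\phi$. $(\sim\mathsf{trans})$: $p\sim q,q\sim r$ / $p\sim r$; $(\nsim\mathsf{trans})$: $p\nsim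 q,q\sim r$ / $p\nsim r$. $(\neg\sim)$: $\neg\phi\sim\chi$ / $\phi\sim\chi$; $(\neg\nsim)$: $\neg\phi\nsim\chi$ / $\phi\nsim\chi$. $(\circ\sim)$: $\phi\sim\chi_1\circ\chi_2,\mathfrak{m}[\chi_i]$ / $\phi\sim\chi_i$; $(\circ\nsim)$: $\phi\nsim\chi_1\circ\chi_2,\mathfrak{m}[\chi_i]$ / $\phi\nsim\chi_i$. A branch is closed iff it contains one of: (1) $\mathcal{M}[\phi]$ and $\mathcal{M}'[\phi]$ for distinct labels $\mathcal{M},\mathcal{M}'\in\{\mathfrak{t},\mathfrak{m},\mathfrak{f}\}$; (2) $\phi\sim\chi$ and $\phi\nsim\chi$; (3) $\phi\nsim\phi$. (There is no bound on the number of pairwise $\nsim$-related formulas.) A tableau is closed iff all its branches are closed. There is a tableaux proof of $\phi\vdash_{\mathrm{ETL}_{\mathbf{M}\omega}}\chi$ iff there are closed tableaux beginning with $\{\mathfrak{t}[\phi],\mathfrak{m}[\chi]\}$ and with $\{\mathfrak{t}[\phi],\mathfrak{f}[\chi]\}$. -}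

module Defs where

open import Data.Nat using (ℕ; _≟_)
open import Data.List using (List; []; _∷_; _++_)
open import Data.List.Membership.Propositional using (_∈_)
open import Data.List.Relation.Unary.All using (All)
open import Relation.Binary.PropositionalEquality using (_≡_; _≢_)
open import Relation.Nullary using (yes; no)

data Fm : Set where
  var : ℕ → Fm
  ¬'_ : Fm → Fm
  _∧'_ : Fm → Fm → Fm
  _∨'_ : Fm → Fm → Fm

data Mω : Set where
  ⊤ᴹ ⊥ᴹ : Mω
  mid : ℕ → Mω

_⊓_ : Mω → Mω → Mω
⊤ᴹ ⊓ y = y
⊥ᴹ ⊓ y = ⊥ᴹ
mid i ⊓ ⊤ᴹ = mid i
mid i ⊓ ⊥ᴹ = ⊥ᴹ
mid i ⊓ mid j with i ≟ j
... | yes _ = mid i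
... | no  _ = ⊥ᴹ

_⊔_ : Mω → Mω → Mω
⊤ᴹ ⊔ y = ⊤ᴹ
⊥ᴹ ⊔ y = y
mid i ⊔ ⊤ᴹ = ⊤ᴹ
mid i ⊔ ⊥ᴹ = mid i
mid i ⊔ mid j with i ≟ j
... | yes _ = mid i
... | no  _ = ⊤ᴹ

negᴹ : Mω → Mω
negᴹ ⊤ᴹ = ⊥ᴹ
negᴹ ⊥ᴹ = ⊤ᴹ
negᴹ (mid i) = mid i

Valuation : Set
Valuation = ℕ → Mω

⟦_⟧ : Fm → Valuation → Mω
⟦ var p ⟧ v = v p
⟦ ¬' φ ⟧ v = negᴹ (⟦ φ ⟧ v)
⟦ φ ∧' χ ⟧ v = ⟦ φ ⟧ v ⊓ ⟦ χ ⟧ v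
⟦ φ ∨' χ ⟧ v = ⟦ φ ⟧ v ⊔ ⟦ χ ⟧ v

_⊨_ : Fm → Fm → Set
φ ⊨ χ = ∀ (v : Valuation) → ⟦ φ ⟧ v ≡ ⊤ᴹ → ⟦ χ ⟧ v ≡ ⊤ᴹ

data Label : Set where
  𝔱 𝔪 𝔣 : Label

data Node : Set where
  lab  : Label → Fm → Node
  _∼_  : Fm → Fm → Node
  _≁_  : Fm → Fm → Node

data Rule : List Node → List (List Node) → Set where
  t∧ : ∀ φ χ → Rule (lab 𝔱 (φ ∧' χ) ∷ [])
                    ((lab 𝔱 φ ∷ lab 𝔱 χ ∷ []) ∷ [])
  t∨ : ∀ φ χ → Rule (lab 𝔱 (φ ∨' χ) ∷ [])
                    ((lab 𝔱 φ ∷ []) ∷ (lab 𝔱 χ ∷ []) ∷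
                     (lab 𝔪 φ ∷ lab 𝔪 χ ∷ (φ ≁ χ) ∷ []) ∷ [])
  t¬ : ∀ φ → Rule (lab 𝔱 (¬' φ) ∷ []) ((lab 𝔣 φ ∷ []) ∷ [])
  m∧ : ∀ φ χ → Rule (lab 𝔪 (φ ∧' χ) ∷ [])
                    ((lab 𝔱 φ ∷ lab 𝔪 χ ∷ []) ∷ (lab 𝔪 φ ∷ lab 𝔱 χ ∷ []) ∷
                     (lab 𝔪 φ ∷ lab 𝔪 χ ∷ (φ ∼ χ) ∷ []) ∷ [])
  m∨ : ∀ φ χ → Rule (lab 𝔪 (φ ∨' χ) ∷ [])
                    ((lab 𝔣 φ ∷ lab 𝔪 χ ∷ []) ∷ (lab 𝔪 φ ∷ lab 𝔣 χ ∷ []) ∷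
                     (lab 𝔪 φ ∷ lab 𝔪 χ ∷ (φ ∼ χ) ∷ []) ∷ [])
  m¬ : ∀ φ → Rule (lab 𝔪 (¬' φ) ∷ []) ((lab 𝔪 φ ∷ (φ ∼ (¬' φ)) ∷ []) ∷ [])
  f∧ : ∀ φ χ → Rule (lab 𝔣 (φ ∧' χ) ∷ [])
                    ((lab 𝔣 φ ∷ []) ∷ (lab 𝔣 χ ∷ []) ∷
                     (lab 𝔪 φ ∷ lab 𝔪 χ ∷ (φ ≁ χ) ∷ []) ∷ [])
  f∨ : ∀ φ χ → Rule (lab 𝔣 (φ ∨' χ) ∷ [])
                    ((lab 𝔣 φ ∷ lab 𝔣 χ ∷ []) ∷ [])
  f¬ : ∀ φ → Rule (lab 𝔣 (¬' φ) ∷ []) ((lab 𝔱 φ ∷ []) ∷ [])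
  ∼sym : ∀ φ χ → Rule ((φ ∼ χ) ∷ []) (((χ ∼ φ) ∷ []) ∷ [])
  ≁sym : ∀ φ χ → Rule ((φ ≁ χ) ∷ []) (((χ ≁ φ) ∷ []) ∷ [])
  ∼trans : ∀ p q r → Rule ((var p ∼ var q) ∷ (var q ∼ var r) ∷ [])
                          (((var p ∼ var r) ∷ []) ∷ [])
  ≁trans : ∀ p q r → Rule ((var p ≁ var q) ∷ (var q ∼ var r) ∷ [])
                          (((var p ≁ var r) ∷ []) ∷ [])
  ¬∼ : ∀ φ χ → Rule (((¬' φ) ∼ χ) ∷ []) (((φ ∼ χ) ∷ []) ∷ [])
  ¬≁ : ∀ φ χ → Rule (((¬' φ) ≁ χ) ∷ []) (((φ ≁ χ) ∷ []) ∷ [])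
  ∧∼₁ : ∀ φ χ₁ χ₂ → Rule ((φ ∼ (χ₁ ∧' χ₂)) ∷ lab 𝔪 χ₁ ∷ []) (((φ ∼ χ₁) ∷ []) ∷ [])
  ∧∼₂ : ∀ φ χ₁ χ₂ → Rule ((φ ∼ (χ₁ ∧' χ₂)) ∷ lab 𝔪 χ₂ ∷ []) (((φ ∼ χ₂) ∷ []) ∷ [])
  ∨∼₁ : ∀ φ χ₁ χ₂ → Rule ((φ ∼ (χ₁ ∨' χ₂)) ∷ lab 𝔪 χ₁ ∷ []) (((φ ∼ χ₁) ∷ []) ∷ [])
  ∨∼₂ : ∀ φ χ₁ χ₂ → Rule ((φ ∼ (χ₁ ∨' χ₂)) ∷ lab 𝔪 χ₂ ∷ []) (((φ ∼ χ₂) ∷ []) ∷ [])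
  ∧≁₁ : ∀ φ χ₁ χ₂ → Rule ((φ ≁ (χ₁ ∧' χ₂)) ∷ lab 𝔪 χ₁ ∷ []) (((φ ≁ χ₁) ∷ []) ∷ [])
  ∧≁₂ : ∀ φ χ₁ χ₂ → Rule ((φ ≁ (χ₁ ∧' χ₂)) ∷ lab 𝔪 χ₂ ∷ []) (((φ ≁ χ₂) ∷ []) ∷ [])
  ∨≁₁ : ∀ φ χ₁ χ₂ → Rule ((φ ≁ (χ₁ ∨' χ₂)) ∷ lab 𝔪 χ₁ ∷ []) (((φ ≁ χ₁) ∷ []) ∷ [])
  ∨≁₂ : ∀ φ χ₁ χ₂ → Rule ((φ ≁ (χ₁ ∨' χ₂)) ∷ lab 𝔪 χ₂ ∷ []) (((φ ≁ χ₂) ∷ []) ∷ [])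

-- Closure conditions on a branch (branches regarded as sets: list membership)
data Closed (B : List Node) : Set where
  clash  : ∀ {M M' φ} → M ≢ M' → lab M φ ∈ B → lab M' φ ∈ B → Closed B
  simcl  : ∀ {φ χ} → (φ ∼ χ) ∈ B → (φ ≁ χ) ∈ B → Closed B
  selfcl : ∀ {φ} → (φ ≁ φ) ∈ B → Closed B

data Closable (B : List Node) : Set where
  done : Closed B → Closable B
  step : ∀ {ps cs} → Rule ps cs → All (_∈ B) ps →
         All (λ c → Closable (c ++ B)) cs → Closable B

_⊢_ : Fm → Fm → Set
φ ⊢ χ = Closable (lab 𝔱 φ ∷ lab 𝔪 χ ∷ []) × Closable (lab 𝔱 φ ∷ lab 𝔣 χ ∷ [])
  where open import Data.Product using (_×_)

-- Soundness: for each rule, a valuation satisfying its premises satisfies one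
-- of its branches, and a closed branch is unsatisfiable.
--
-- Completeness: decompose 𝔱[φ] and 𝔪[χ] (or 𝔣[χ]) down to variables along every
-- branch. On each resulting branch a variable gets the value its label names,
-- a 𝔪-labelled variable getting the middle element indexed by its class under
-- the ∼-constraints met during the decomposition. A 𝔪-labelled formula is traced
-- through its 𝔪-labelled parts to an anchor variable, and the (∘∼), (∘≁), (¬∼),
-- (¬≁) rules push ∼ and ≁ between formulas down to their anchors. Either this
-- valuation realises every label, so φ is ⊤ while χ is not, contradicting φ ⊨ χ;
-- or the branch has a label clash, or a ≁ between two ∼-connected variables,
-- which (≁trans) turns into a closing p ≁ p.

module Submission where

open import Defs
open import Data.Empty using (⊥-elim)
open import Data.List using (List; []; _∷_; _++_)
open import Data.List.Membership.Propositional using (_∈_)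
open import Data.List.Relation.Binary.Subset.Propositional using (_⊆_)
open import Data.List.Relation.Binary.Subset.Propositional.Properties
  using (⊆-refl; xs⊆x∷xs; xs⊆xs++ys; xs⊆ys++xs; ∷⁺ʳ; ++⁺ʳ; ∈-∷⁺ʳ)
open import Data.List.Relation.Unary.All as All using (All; []; _∷_)
open import Data.List.Relation.Unary.All.Properties using (++⁺; ++⁻)
open import Data.List.Relation.Unary.Any using (Any; here; there)
open import Data.Maybe using (Maybe; just; nothing; maybe; _<∣>_)
open import Data.Nat using (ℕ; _≟_)
open import Data.Product using (_×_; _,_; proj₁; proj₂; ∃-syntax; uncurry)
open import Data.Sum using (_⊎_; inj₁; inj₂; map₂)
open import Function using (_∘_)
open import Relation.Binary.Construct.Closure.Equivalence as EqClosure using (EqClosure)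
open import Relation.Binary.Construct.Closure.ReflexiveTransitive using (ε; _◅_; _◅◅_)
open import Relation.Binary.Construct.Closure.Symmetric using (fwd; bwd)
open import Relation.Binary.Definitions using (DecidableEquality)
open import Relation.Binary.PropositionalEquality using (_≡_; _≢_; refl; sym; trans; cong; cong₂)
open import Relation.Nullary using (¬_; yes; no)

private
  variable
    i j k p q : ℕ
    x : Mω
    φ χ ψ : Fm
    M M₁ M₂ : Label
    n n₁ n₂ : Node
    B B′ : List Node
    ps : List Node
    cs : List (List Node)
    v : Valuation

-- The lattice Mω

mid-injective : mid i ≡ mid j → i ≡ j
mid-injective refl = refl

mid⊓mid-same : i ≡ j → mid i ⊓ mid j ≡ mid i
mid⊓mid-same {i} refl with i ≟ i
... | yes _ = refl
... | no i≢i = ⊥-elim (i≢i refl)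

mid⊔mid-same : i ≡ j → mid i ⊔ mid j ≡ mid i
mid⊔mid-same {i} refl with i ≟ i
... | yes _ = refl
... | no i≢i = ⊥-elim (i≢i refl)

mid⊓mid-apart : i ≢ j → mid i ⊓ mid j ≡ ⊥ᴹ
mid⊓mid-apart {i} {j} i≢j with i ≟ j
... | yes i≡j = ⊥-elim (i≢j i≡j)
... | no _ = refl

mid⊔mid-apart : i ≢ j → mid i ⊔ mid j ≡ ⊤ᴹ
mid⊔mid-apart {i} {j} i≢j with i ≟ j
... | yes i≡j = ⊥-elim (i≢j i≡j)
... | no _ = refl

⊓-zeroʳ : ∀ x → x ⊓ ⊥ᴹ ≡ ⊥ᴹ
⊓-zeroʳ ⊤ᴹ = refl
⊓-zeroʳ ⊥ᴹ = refl
⊓-zeroʳ (mid _) = refl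

⊔-zeroʳ : ∀ x → x ⊔ ⊤ᴹ ≡ ⊤ᴹ
⊔-zeroʳ ⊤ᴹ = refl
⊔-zeroʳ ⊥ᴹ = refl
⊔-zeroʳ (mid _) = refl

SameMiddle : Mω → Mω → Set
SameMiddle x y = ∃[ i ] x ≡ mid i × y ≡ mid i

DistinctMiddles : Mω → Mω → Set
DistinctMiddles x y = ∃[ i ] ∃[ j ] i ≢ j × x ≡ mid i × y ≡ mid j

⊓-⊤ᴹ-inv : ∀ x y → x ⊓ y ≡ ⊤ᴹ → x ≡ ⊤ᴹ × y ≡ ⊤ᴹ
⊓-⊤ᴹ-inv ⊤ᴹ _ e = refl , e
⊓-⊤ᴹ-inv (mid _) ⊤ᴹ ()
⊓-⊤ᴹ-inv (mid i) (mid j) e with i ≟ j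
... | yes _ with () ← e
... | no _ with () ← e

⊔-⊥ᴹ-inv : ∀ x y → x ⊔ y ≡ ⊥ᴹ → x ≡ ⊥ᴹ × y ≡ ⊥ᴹ
⊔-⊥ᴹ-inv ⊥ᴹ _ e = refl , e
⊔-⊥ᴹ-inv (mid _) ⊥ᴹ ()
⊔-⊥ᴹ-inv (mid i) (mid j) e with i ≟ j
... | yes _ with () ← e
... | no _ with () ← e

⊔-⊤ᴹ-inv : ∀ x y → x ⊔ y ≡ ⊤ᴹ → x ≡ ⊤ᴹ ⊎ y ≡ ⊤ᴹ ⊎ DistinctMiddles x y
⊔-⊤ᴹ-inv ⊤ᴹ _ _ = inj₁ refl
⊔-⊤ᴹ-inv ⊥ᴹ _ e = inj₂ (inj₁ e)
⊔-⊤ᴹ-inv (mid _) ⊤ᴹ _ = inj₂ (inj₁ refl)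
⊔-⊤ᴹ-inv (mid i) (mid j) e with i ≟ j
... | yes _ with () ← e
... | no i≢j = inj₂ (inj₂ (i , j , i≢j , refl , refl))

⊓-⊥ᴹ-inv : ∀ x y → x ⊓ y ≡ ⊥ᴹ → x ≡ ⊥ᴹ ⊎ y ≡ ⊥ᴹ ⊎ DistinctMiddles x y
⊓-⊥ᴹ-inv ⊥ᴹ _ _ = inj₁ refl
⊓-⊥ᴹ-inv ⊤ᴹ _ e = inj₂ (inj₁ e)
⊓-⊥ᴹ-inv (mid _) ⊥ᴹ _ = inj₂ (inj₁ refl)
⊓-⊥ᴹ-inv (mid i) (mid j) e with i ≟ j
... | yes _ with () ← e
... | no i≢j = inj₂ (inj₂ (i , j , i≢j , refl , refl))

⊓-mid-inv : ∀ x y → x ⊓ y ≡ mid k →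
  (x ≡ ⊤ᴹ × y ≡ mid k) ⊎ (x ≡ mid k × y ≡ ⊤ᴹ) ⊎ (x ≡ mid k × y ≡ mid k)
⊓-mid-inv ⊤ᴹ _ e = inj₁ (refl , e)
⊓-mid-inv (mid _) ⊤ᴹ e = inj₂ (inj₁ (e , refl))
⊓-mid-inv (mid i) (mid j) e with i ≟ j
... | yes refl = inj₂ (inj₂ (e , e))
... | no _ with () ← e

⊔-mid-inv : ∀ x y → x ⊔ y ≡ mid k →
  (x ≡ ⊥ᴹ × y ≡ mid k) ⊎ (x ≡ mid k × y ≡ ⊥ᴹ) ⊎ (x ≡ mid k × y ≡ mid k)
⊔-mid-inv ⊥ᴹ _ e = inj₁ (refl , e)
⊔-mid-inv (mid _) ⊥ᴹ e = inj₂ (inj₁ (e , refl))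
⊔-mid-inv (mid i) (mid j) e with i ≟ j
... | yes refl = inj₂ (inj₂ (e , e))
... | no _ with () ← e

⊓-midˡ : ∀ x y → x ⊓ y ≡ mid i → x ≡ mid k → x ≡ mid i
⊓-midˡ (mid _) ⊤ᴹ e refl = e
⊓-midˡ (mid l) (mid j) e refl with l ≟ j
... | yes refl = e
... | no _ with () ← e

⊓-midʳ : ∀ x y → x ⊓ y ≡ mid i → y ≡ mid k → y ≡ mid i
⊓-midʳ ⊤ᴹ (mid _) e refl = e
⊓-midʳ (mid l) (mid j) e refl with l ≟ j
... | yes refl = e
... | no _ with () ← e

⊔-midˡ : ∀ x y → x ⊔ y ≡ mid i → x ≡ mid k → x ≡ mid i
⊔-midˡ (mid _) ⊥ᴹ e refl = e
⊔-midˡ (mid l) (mid j) e refl with l ≟ j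
... | yes refl = e
... | no _ with () ← e

⊔-midʳ : ∀ x y → x ⊔ y ≡ mid i → y ≡ mid k → y ≡ mid i
⊔-midʳ ⊥ᴹ (mid _) e refl = e
⊔-midʳ (mid l) (mid j) e refl with l ≟ j
... | yes refl = e
... | no _ with () ← e

negᴹ-⊤ᴹ-inv : ∀ x → negᴹ x ≡ ⊤ᴹ → x ≡ ⊥ᴹ
negᴹ-⊤ᴹ-inv ⊥ᴹ _ = refl

negᴹ-⊥ᴹ-inv : ∀ x → negᴹ x ≡ ⊥ᴹ → x ≡ ⊤ᴹ
negᴹ-⊥ᴹ-inv ⊤ᴹ _ = refl

negᴹ-mid-inv : ∀ x → negᴹ x ≡ mid k → x ≡ mid k
negᴹ-mid-inv (mid _) e = e

-- Soundness

Labelled : Label → Mω → Set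
Labelled 𝔱 x = x ≡ ⊤ᴹ
Labelled 𝔪 x = ∃[ i ] x ≡ mid i
Labelled 𝔣 x = x ≡ ⊥ᴹ

labelled-unique : ∀ M₁ M₂ → Labelled M₁ x → Labelled M₂ x → M₁ ≡ M₂
labelled-unique 𝔱 𝔱 _ _ = refl
labelled-unique 𝔪 𝔪 _ _ = refl
labelled-unique 𝔣 𝔣 _ _ = refl
labelled-unique 𝔱 𝔪 refl (_ , ())
labelled-unique 𝔱 𝔣 refl ()
labelled-unique 𝔪 𝔱 (_ , refl) ()
labelled-unique 𝔪 𝔣 (_ , refl) ()
labelled-unique 𝔣 𝔱 refl ()
labelled-unique 𝔣 𝔪 refl (_ , ())

_⊩_ : Valuation → Node → Set
v ⊩ lab M φ = Labelled M (⟦ φ ⟧ v)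
v ⊩ (φ ∼ χ) = SameMiddle (⟦ φ ⟧ v) (⟦ χ ⟧ v)
v ⊩ (φ ≁ χ) = DistinctMiddles (⟦ φ ⟧ v) (⟦ χ ⟧ v)

closed-unsat : Closed B → ¬ All (v ⊩_) B
closed-unsat (clash {M} {M′} M≢M′ m m′) sat =
  M≢M′ (labelled-unique M M′ (All.lookup sat m) (All.lookup sat m′))
closed-unsat (simcl s a) sat with All.lookup sat s | All.lookup sat a
... | i , e₁ , e₂ | _ , _ , i′≢j′ , e₁′ , e₂′ =
  i′≢j′ (trans (mid-injective (trans (sym e₁′) e₁)) (mid-injective (trans (sym e₂) e₂′)))
closed-unsat (selfcl a) sat with All.lookup sat a
... | _ , _ , i≢j , e₁ , e₂ = i≢j (mid-injective (trans (sym e₁) e₂))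

only : v ⊩ n → Any (All (v ⊩_)) ((n ∷ []) ∷ [])
only s = here (s ∷ [])

rule-sound : Rule ps cs → All (v ⊩_) ps → Any (All (v ⊩_)) cs
rule-sound {v = v} (t∧ φ _) (e ∷ []) =
  let e₁ , e₂ = ⊓-⊤ᴹ-inv (⟦ φ ⟧ v) _ e in here (e₁ ∷ e₂ ∷ [])
rule-sound {v = v} (t∨ φ _) (e ∷ []) with ⊔-⊤ᴹ-inv (⟦ φ ⟧ v) _ e
... | inj₁ e₁ = here (e₁ ∷ [])
... | inj₂ (inj₁ e₂) = there (here (e₂ ∷ []))
... | inj₂ (inj₂ d@(i , j , _ , e₁ , e₂)) = there (there (here ((i , e₁) ∷ (j , e₂) ∷ d ∷ [])))
rule-sound {v = v} (t¬ φ) (e ∷ []) = only (negᴹ-⊤ᴹ-inv (⟦ φ ⟧ v) e)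
rule-sound {v = v} (m∧ φ _) ((k , e) ∷ []) with ⊓-mid-inv (⟦ φ ⟧ v) _ e
... | inj₁ (e₁ , e₂) = here (e₁ ∷ (k , e₂) ∷ [])
... | inj₂ (inj₁ (e₁ , e₂)) = there (here ((k , e₁) ∷ e₂ ∷ []))
... | inj₂ (inj₂ (e₁ , e₂)) = there (there (here ((k , e₁) ∷ (k , e₂) ∷ (k , e₁ , e₂) ∷ [])))
rule-sound {v = v} (m∨ φ _) ((k , e) ∷ []) with ⊔-mid-inv (⟦ φ ⟧ v) _ e
... | inj₁ (e₁ , e₂) = here (e₁ ∷ (k , e₂) ∷ [])
... | inj₂ (inj₁ (e₁ , e₂)) = there (here ((k , e₁) ∷ e₂ ∷ []))
... | inj₂ (inj₂ (e₁ , e₂)) = there (there (here ((k , e₁) ∷ (k , e₂) ∷ (k , e₁ , e₂) ∷ [])))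
rule-sound {v = v} (m¬ φ) ((k , e) ∷ []) =
  let e′ = negᴹ-mid-inv (⟦ φ ⟧ v) e in here ((k , e′) ∷ (k , e′ , e) ∷ [])
rule-sound {v = v} (f∧ φ _) (e ∷ []) with ⊓-⊥ᴹ-inv (⟦ φ ⟧ v) _ e
... | inj₁ e₁ = here (e₁ ∷ [])
... | inj₂ (inj₁ e₂) = there (here (e₂ ∷ []))
... | inj₂ (inj₂ d@(i , j , _ , e₁ , e₂)) = there (there (here ((i , e₁) ∷ (j , e₂) ∷ d ∷ [])))
rule-sound {v = v} (f∨ φ _) (e ∷ []) =
  let e₁ , e₂ = ⊔-⊥ᴹ-inv (⟦ φ ⟧ v) _ e in here (e₁ ∷ e₂ ∷ [])
rule-sound {v = v} (f¬ φ) (e ∷ []) = only (negᴹ-⊥ᴹ-inv (⟦ φ ⟧ v) e)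
rule-sound (∼sym _ _) ((i , e₁ , e₂) ∷ []) = only (i , e₂ , e₁)
rule-sound (≁sym _ _) ((i , j , i≢j , e₁ , e₂) ∷ []) = only (j , i , i≢j ∘ sym , e₂ , e₁)
rule-sound (∼trans _ _ _) ((i , e₁ , e₂) ∷ (_ , e₂′ , e₃) ∷ []) =
  only (i , e₁ , trans e₃ (trans (sym e₂′) e₂))
rule-sound (≁trans _ _ _) ((i , j , i≢j , e₁ , e₂) ∷ (_ , e₂′ , e₃) ∷ []) =
  only (i , j , i≢j , e₁ , trans e₃ (trans (sym e₂′) e₂))
rule-sound {v = v} (¬∼ φ _) ((i , e₁ , e₂) ∷ []) = only (i , negᴹ-mid-inv (⟦ φ ⟧ v) e₁ , e₂)
rule-sound {v = v} (¬≁ φ _) ((i , j , i≢j , e₁ , e₂) ∷ []) =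
  only (i , j , i≢j , negᴹ-mid-inv (⟦ φ ⟧ v) e₁ , e₂)
rule-sound {v = v} (∧∼₁ _ χ₁ _) ((i , e , e′) ∷ (_ , m) ∷ []) = only (i , e , ⊓-midˡ (⟦ χ₁ ⟧ v) _ e′ m)
rule-sound {v = v} (∧∼₂ _ χ₁ _) ((i , e , e′) ∷ (_ , m) ∷ []) = only (i , e , ⊓-midʳ (⟦ χ₁ ⟧ v) _ e′ m)
rule-sound {v = v} (∨∼₁ _ χ₁ _) ((i , e , e′) ∷ (_ , m) ∷ []) = only (i , e , ⊔-midˡ (⟦ χ₁ ⟧ v) _ e′ m)
rule-sound {v = v} (∨∼₂ _ χ₁ _) ((i , e , e′) ∷ (_ , m) ∷ []) = only (i , e , ⊔-midʳ (⟦ χ₁ ⟧ v) _ e′ m)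
rule-sound {v = v} (∧≁₁ _ χ₁ _) ((i , j , i≢j , e , e′) ∷ (_ , m) ∷ []) =
  only (i , j , i≢j , e , ⊓-midˡ (⟦ χ₁ ⟧ v) _ e′ m)
rule-sound {v = v} (∧≁₂ _ χ₁ _) ((i , j , i≢j , e , e′) ∷ (_ , m) ∷ []) =
  only (i , j , i≢j , e , ⊓-midʳ (⟦ χ₁ ⟧ v) _ e′ m)
rule-sound {v = v} (∨≁₁ _ χ₁ _) ((i , j , i≢j , e , e′) ∷ (_ , m) ∷ []) =
  only (i , j , i≢j , e , ⊔-midˡ (⟦ χ₁ ⟧ v) _ e′ m)
rule-sound {v = v} (∨≁₂ _ χ₁ _) ((i , j , i≢j , e , e′) ∷ (_ , m) ∷ []) =
  only (i , j , i≢j , e , ⊔-midʳ (⟦ χ₁ ⟧ v) _ e′ m)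

mutual
  closable-unsat : Closable B → ¬ All (v ⊩_) B
  closable-unsat (done c) = closed-unsat c
  closable-unsat (step r ps cls) sat =
    branches-unsat cls (rule-sound r (All.map (All.lookup sat) ps)) sat

  branches-unsat : All (λ c → Closable (c ++ B)) cs → Any (All (v ⊩_)) cs → ¬ All (v ⊩_) B
  branches-unsat (cl ∷ _) (here sat-c) sat = closable-unsat cl (++⁺ sat-c sat)
  branches-unsat (_ ∷ cls) (there sat-cs) sat = branches-unsat cls sat-cs sat

soundness : φ ⊢ χ → φ ⊨ χ
soundness {χ = χ} (closes-𝔪 , closes-𝔣) v φ-true with ⟦ χ ⟧ v in eq
... | ⊤ᴹ = refl
... | mid i = ⊥-elim (closable-unsat closes-𝔪 (φ-true ∷ (i , eq) ∷ []))
... | ⊥ᴹ = ⊥-elim (closable-unsat closes-𝔣 (φ-true ∷ eq ∷ []))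

-- Union–find

merge : ℕ → ℕ → ℕ → ℕ
merge a b y with y ≟ b
... | yes _ = a
... | no _ = y

merge-identifies : ∀ a b → merge a b a ≡ merge a b b
merge-identifies a b with a ≟ b | b ≟ b
... | yes _ | yes _ = refl
... | no _ | yes _ = refl
... | _ | no b≢b = ⊥-elim (b≢b refl)

classOf : List (ℕ × ℕ) → ℕ → ℕ
classOf [] x = x
classOf ((p , q) ∷ S) x = merge (classOf S p) (classOf S q) (classOf S x)

classOf-respects : (S : List (ℕ × ℕ)) → All (λ (p , q) → classOf S p ≡ classOf S q) S
classOf-respects [] = []
classOf-respects ((p , q) ∷ S) =
  merge-identifies (classOf S p) (classOf S q) ∷
  All.map (cong (merge (classOf S p) (classOf S q))) (classOf-respects S)

Edge : List (ℕ × ℕ) → ℕ → ℕ → Set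
Edge S x y = (x , y) ∈ S

classOf-connected : (S : List (ℕ × ℕ)) {x y : ℕ} → classOf S x ≡ classOf S y → EqClosure (Edge S) x y
classOf-connected [] refl = ε
classOf-connected ((p , q) ∷ S) {x} {y} eq with classOf S x ≟ classOf S q | classOf S y ≟ classOf S q
... | yes x~q | yes y~q = EqClosure.map there (classOf-connected S (trans x~q (sym y~q)))
... | yes x~q | no _ =
  EqClosure.map there (classOf-connected S x~q) ◅◅
  bwd (here refl) ◅ EqClosure.map there (classOf-connected S eq)
... | no _ | yes y~q =
  EqClosure.map there (classOf-connected S eq) ◅◅
  fwd (here refl) ◅ EqClosure.map there (EqClosure.symmetric _ (classOf-connected S y~q))
... | no _ | no _ = EqClosure.map there (classOf-connected S eq)

-- Derivable nodes and expansions

closed-mono : B ⊆ B′ → Closed B → Closed B′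
closed-mono B⊆B′ (clash M≢M′ m m′) = clash M≢M′ (B⊆B′ m) (B⊆B′ m′)
closed-mono B⊆B′ (simcl s a) = simcl (B⊆B′ s) (B⊆B′ a)
closed-mono B⊆B′ (selfcl a) = selfcl (B⊆B′ a)

mutual
  closable-mono : B ⊆ B′ → Closable B → Closable B′
  closable-mono B⊆B′ (done c) = done (closed-mono B⊆B′ c)
  closable-mono B⊆B′ (step r ps cls) = step r (All.map B⊆B′ ps) (branches-mono B⊆B′ cls)

  branches-mono : B ⊆ B′ → All (λ c → Closable (c ++ B)) cs → All (λ c → Closable (c ++ B′)) cs
  branches-mono _ [] = []
  branches-mono {cs = c ∷ _} B⊆B′ (cl ∷ cls) =
    closable-mono (++⁺ʳ c B⊆B′) cl ∷ branches-mono B⊆B′ cls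

Derivable : List Node → Node → Set
Derivable B n = ∀ {B′} → B ⊆ B′ → Closable (n ∷ B′) → Closable B′

∈⇒derivable : n ∈ B → Derivable B n
∈⇒derivable n∈B B⊆B′ = closable-mono (∈-∷⁺ʳ (B⊆B′ n∈B) ⊆-refl)

derivable-mono : B ⊆ B′ → Derivable B n → Derivable B′ n
derivable-mono B⊆B′ d B′⊆B″ = d (B′⊆B″ ∘ B⊆B′)

derivable-cut : Derivable B n₁ → (∀ {B′} → B ⊆ B′ → n₁ ∈ B′ → Derivable B′ n₂) → Derivable B n₂
derivable-cut {n₁ = n₁} {n₂ = n₂} d k {B′} B⊆B′ cl =
  d B⊆B′ (k (xs⊆x∷xs B′ n₁ ∘ B⊆B′) (here refl) ⊆-refl (closable-mono (∷⁺ʳ n₂ (xs⊆x∷xs B′ n₁)) cl))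

derivable-premises : All (Derivable B) ps →
  (∀ {B′} → B ⊆ B′ → All (_∈ B′) ps → Derivable B′ n) → Derivable B n
derivable-premises [] k = k ⊆-refl []
derivable-premises (d ∷ ds) k = derivable-cut d λ B⊆B′ p∈B′ →
  derivable-premises (All.map (derivable-mono B⊆B′) ds) λ B′⊆B″ ps∈B″ →
    k (B′⊆B″ ∘ B⊆B′) (B′⊆B″ p∈B′ ∷ ps∈B″)

derivable-rule : Rule ps ((n ∷ []) ∷ []) → All (Derivable B) ps → Derivable B n
derivable-rule r ds = derivable-premises ds λ _ ps∈B′ B′⊆B″ cl → step r (All.map B′⊆B″ ps∈B′) (cl ∷ [])

derive₁ : Rule (n₁ ∷ []) ((n ∷ []) ∷ []) → Derivable B n₁ → Derivable B n
derive₁ r d = derivable-rule r (d ∷ [])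

derive₂ : Rule (n₁ ∷ n₂ ∷ []) ((n ∷ []) ∷ []) → Derivable B n₁ → Derivable B n₂ → Derivable B n
derive₂ r d₁ d₂ = derivable-rule r (d₁ ∷ d₂ ∷ [])

self-apart-closes : Derivable B (φ ≁ φ) → Closable B
self-apart-closes d = d ⊆-refl (done (selfcl (here refl)))

-- Constructor names follow the rule branch taken: t∨₃ is the third branch of (t∨).
data Expansion (B : List Node) : Label → Fm → Set

Expanded : List Node → Label → Fm → Set
Expanded B M ψ = lab M ψ ∈ B × Expansion B M ψ

data Expansion B where
  atom : Expansion B M (var p)
  t∧   : Expanded B 𝔱 φ → Expanded B 𝔱 χ → Expansion B 𝔱 (φ ∧' χ)
  t∨₁  : Expanded B 𝔱 φ → Expansion B 𝔱 (φ ∨' χ)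
  t∨₂  : Expanded B 𝔱 χ → Expansion B 𝔱 (φ ∨' χ)
  t∨₃  : Expanded B 𝔪 φ → Expanded B 𝔪 χ → (φ ≁ χ) ∈ B → Expansion B 𝔱 (φ ∨' χ)
  t¬   : Expanded B 𝔣 φ → Expansion B 𝔱 (¬' φ)
  m∧₁  : Expanded B 𝔱 φ → Expanded B 𝔪 χ → Expansion B 𝔪 (φ ∧' χ)
  m∧₂  : Expanded B 𝔪 φ → Expanded B 𝔱 χ → Expansion B 𝔪 (φ ∧' χ)
  m∧₃  : Expanded B 𝔪 φ → Expanded B 𝔪 χ → (φ ∼ χ) ∈ B → Expansion B 𝔪 (φ ∧' χ)
  m∨₁  : Expanded B 𝔣 φ → Expanded B 𝔪 χ → Expansion B 𝔪 (φ ∨' χ)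
  m∨₂  : Expanded B 𝔪 φ → Expanded B 𝔣 χ → Expansion B 𝔪 (φ ∨' χ)
  m∨₃  : Expanded B 𝔪 φ → Expanded B 𝔪 χ → (φ ∼ χ) ∈ B → Expansion B 𝔪 (φ ∨' χ)
  m¬   : Expanded B 𝔪 φ → Expansion B 𝔪 (¬' φ)
  f∧₁  : Expanded B 𝔣 φ → Expansion B 𝔣 (φ ∧' χ)
  f∧₂  : Expanded B 𝔣 χ → Expansion B 𝔣 (φ ∧' χ)
  f∧₃  : Expanded B 𝔪 φ → Expanded B 𝔪 χ → (φ ≁ χ) ∈ B → Expansion B 𝔣 (φ ∧' χ)
  f∨   : Expanded B 𝔣 φ → Expanded B 𝔣 χ → Expansion B 𝔣 (φ ∨' χ)
  f¬   : Expanded B 𝔱 φ → Expansion B 𝔣 (¬' φ)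

expanded-mono : B ⊆ B′ → Expanded B M ψ → Expanded B′ M ψ
expanded-mono s (m , atom) = s m , atom
expanded-mono s (m , t∧ a b) = s m , t∧ (expanded-mono s a) (expanded-mono s b)
expanded-mono s (m , t∨₁ a) = s m , t∨₁ (expanded-mono s a)
expanded-mono s (m , t∨₂ b) = s m , t∨₂ (expanded-mono s b)
expanded-mono s (m , t∨₃ a b r) = s m , t∨₃ (expanded-mono s a) (expanded-mono s b) (s r)
expanded-mono s (m , t¬ a) = s m , t¬ (expanded-mono s a)
expanded-mono s (m , m∧₁ a b) = s m , m∧₁ (expanded-mono s a) (expanded-mono s b)
expanded-mono s (m , m∧₂ a b) = s m , m∧₂ (expanded-mono s a) (expanded-mono s b)
expanded-mono s (m , m∧₃ a b r) = s m , m∧₃ (expanded-mono s a) (expanded-mono s b) (s r)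
expanded-mono s (m , m∨₁ a b) = s m , m∨₁ (expanded-mono s a) (expanded-mono s b)
expanded-mono s (m , m∨₂ a b) = s m , m∨₂ (expanded-mono s a) (expanded-mono s b)
expanded-mono s (m , m∨₃ a b r) = s m , m∨₃ (expanded-mono s a) (expanded-mono s b) (s r)
expanded-mono s (m , m¬ a) = s m , m¬ (expanded-mono s a)
expanded-mono s (m , f∧₁ a) = s m , f∧₁ (expanded-mono s a)
expanded-mono s (m , f∧₂ b) = s m , f∧₂ (expanded-mono s b)
expanded-mono s (m , f∧₃ a b r) = s m , f∧₃ (expanded-mono s a) (expanded-mono s b) (s r)
expanded-mono s (m , f∨ a b) = s m , f∨ (expanded-mono s a) (expanded-mono s b)
expanded-mono s (m , f¬ a) = s m , f¬ (expanded-mono s a)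

mutual
  expand : ∀ M ψ → lab M ψ ∈ B → (∀ {B′} → B ⊆ B′ → Expansion B′ M ψ → Closable B′) → Closable B
  expand M (var p) _ k = k ⊆-refl atom
  expand 𝔱 (φ ∧' χ) m k = step (t∧ φ χ) (m ∷ [])
    (expand₂ [] (λ s _ a b → k s (t∧ a b)) ∷ [])
  expand 𝔱 (φ ∨' χ) m k = step (t∨ φ χ) (m ∷ [])
    (expand₁ [] (λ s _ a → k s (t∨₁ a)) ∷
     expand₁ [] (λ s _ b → k s (t∨₂ b)) ∷
     expand₂ ((φ ≁ χ) ∷ []) (λ s rs a b → k s (t∨₃ a b (All.head rs))) ∷ [])
  expand 𝔱 (¬' φ) m k = step (t¬ φ) (m ∷ [])
    (expand₁ [] (λ s _ a → k s (t¬ a)) ∷ [])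
  expand 𝔪 (φ ∧' χ) m k = step (m∧ φ χ) (m ∷ [])
    (expand₂ [] (λ s _ a b → k s (m∧₁ a b)) ∷
     expand₂ [] (λ s _ a b → k s (m∧₂ a b)) ∷
     expand₂ ((φ ∼ χ) ∷ []) (λ s rs a b → k s (m∧₃ a b (All.head rs))) ∷ [])
  expand 𝔪 (φ ∨' χ) m k = step (m∨ φ χ) (m ∷ [])
    (expand₂ [] (λ s _ a b → k s (m∨₁ a b)) ∷
     expand₂ [] (λ s _ a b → k s (m∨₂ a b)) ∷
     expand₂ ((φ ∼ χ) ∷ []) (λ s rs a b → k s (m∨₃ a b (All.head rs))) ∷ [])
  expand 𝔪 (¬' φ) m k = step (m¬ φ) (m ∷ [])
    (expand₁ ((φ ∼ (¬' φ)) ∷ []) (λ s _ a → k s (m¬ a)) ∷ [])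
  expand 𝔣 (φ ∧' χ) m k = step (f∧ φ χ) (m ∷ [])
    (expand₁ [] (λ s _ a → k s (f∧₁ a)) ∷
     expand₁ [] (λ s _ b → k s (f∧₂ b)) ∷
     expand₂ ((φ ≁ χ) ∷ []) (λ s rs a b → k s (f∧₃ a b (All.head rs))) ∷ [])
  expand 𝔣 (φ ∨' χ) m k = step (f∨ φ χ) (m ∷ [])
    (expand₂ [] (λ s _ a b → k s (f∨ a b)) ∷ [])
  expand 𝔣 (¬' φ) m k = step (f¬ φ) (m ∷ [])
    (expand₁ [] (λ s _ a → k s (f¬ a)) ∷ [])

  expanded : lab M ψ ∈ B → (∀ {B′} → B ⊆ B′ → Expanded B′ M ψ → Closable B′) → Closable B
  expanded m k = expand _ _ m λ s e → k s (s m , e)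

  expand₁ : ∀ extra →
    (∀ {B′} → B ⊆ B′ → All (_∈ B′) extra → Expanded B′ M φ → Closable B′) →
    Closable (lab M φ ∷ extra ++ B)
  expand₁ {B} extra k = expanded (here refl) λ s a →
    k (s ∘ there ∘ xs⊆ys++xs B extra) (All.tabulate (s ∘ there ∘ xs⊆xs++ys extra B)) a

  expand₂ : ∀ extra →
    (∀ {B′} → B ⊆ B′ → All (_∈ B′) extra → Expanded B′ M₁ φ → Expanded B′ M₂ χ → Closable B′) →
    Closable (lab M₁ φ ∷ lab M₂ χ ∷ extra ++ B)
  expand₂ extra k = expand₁ (lab _ _ ∷ extra) λ s ms a → expanded (All.head ms) λ s′ b →
    k (s′ ∘ s) (All.map s′ (All.tail ms)) (expanded-mono s′ a) b

-- The countermodel gives a 𝔪-labelled formula the middle value of this variable.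
anchor : Expanded B 𝔪 ψ → ℕ
anchor {ψ = var p} (_ , atom) = p
anchor (_ , m∧₁ _ b) = anchor b
anchor (_ , m∧₂ a _) = anchor a
anchor (_ , m∧₃ a _ _) = anchor a
anchor (_ , m∨₁ _ b) = anchor b
anchor (_ , m∨₂ a _) = anchor a
anchor (_ , m∨₃ a _ _) = anchor a
anchor (_ , m¬ a) = anchor a

similar-anchor : Derivable B (φ ∼ χ) → (b : Expanded B 𝔪 χ) → Derivable B (φ ∼ var (anchor b))
similar-anchor d (_ , atom) = d
similar-anchor d (_ , m∧₁ _ b) = similar-anchor (derive₂ (∧∼₂ _ _ _) d (∈⇒derivable (proj₁ b))) b
similar-anchor d (_ , m∧₂ a _) = similar-anchor (derive₂ (∧∼₁ _ _ _) d (∈⇒derivable (proj₁ a))) a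
similar-anchor d (_ , m∧₃ a _ _) = similar-anchor (derive₂ (∧∼₁ _ _ _) d (∈⇒derivable (proj₁ a))) a
similar-anchor d (_ , m∨₁ _ b) = similar-anchor (derive₂ (∨∼₂ _ _ _) d (∈⇒derivable (proj₁ b))) b
similar-anchor d (_ , m∨₂ a _) = similar-anchor (derive₂ (∨∼₁ _ _ _) d (∈⇒derivable (proj₁ a))) a
similar-anchor d (_ , m∨₃ a _ _) = similar-anchor (derive₂ (∨∼₁ _ _ _) d (∈⇒derivable (proj₁ a))) a
similar-anchor d (_ , m¬ a) =
  similar-anchor (derive₁ (∼sym _ _) (derive₁ (¬∼ _ _) (derive₁ (∼sym _ _) d))) a

apart-anchor : Derivable B (φ ≁ χ) → (b : Expanded B 𝔪 χ) → Derivable B (φ ≁ var (anchor b))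
apart-anchor d (_ , atom) = d
apart-anchor d (_ , m∧₁ _ b) = apart-anchor (derive₂ (∧≁₂ _ _ _) d (∈⇒derivable (proj₁ b))) b
apart-anchor d (_ , m∧₂ a _) = apart-anchor (derive₂ (∧≁₁ _ _ _) d (∈⇒derivable (proj₁ a))) a
apart-anchor d (_ , m∧₃ a _ _) = apart-anchor (derive₂ (∧≁₁ _ _ _) d (∈⇒derivable (proj₁ a))) a
apart-anchor d (_ , m∨₁ _ b) = apart-anchor (derive₂ (∨≁₂ _ _ _) d (∈⇒derivable (proj₁ b))) b
apart-anchor d (_ , m∨₂ a _) = apart-anchor (derive₂ (∨≁₁ _ _ _) d (∈⇒derivable (proj₁ a))) a
apart-anchor d (_ , m∨₃ a _ _) = apart-anchor (derive₂ (∨≁₁ _ _ _) d (∈⇒derivable (proj₁ a))) a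
apart-anchor d (_ , m¬ a) =
  apart-anchor (derive₁ (≁sym _ _) (derive₁ (¬≁ _ _) (derive₁ (≁sym _ _) d))) a

similar-anchors : Derivable B (φ ∼ χ) → (a : Expanded B 𝔪 φ) (b : Expanded B 𝔪 χ) →
  Derivable B (var (anchor a) ∼ var (anchor b))
similar-anchors d a b = derive₁ (∼sym _ _) (similar-anchor (derive₁ (∼sym _ _) (similar-anchor d b)) a)

apart-anchors : Derivable B (φ ≁ χ) → (a : Expanded B 𝔪 φ) (b : Expanded B 𝔪 χ) →
  Derivable B (var (anchor a) ≁ var (anchor b))
apart-anchors d a b = derive₁ (≁sym _ _) (apart-anchor (derive₁ (≁sym _ _) (apart-anchor d b)) a)

VarSimilar : List Node → ℕ × ℕ → Set
VarSimilar B (p , q) = Derivable B (var p ∼ var q)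

-- Pairs of anchors that the countermodel must put in one class.
agreements : Expanded B M ψ → List (ℕ × ℕ)
agreements (_ , atom) = []
agreements (_ , t∧ a b) = agreements a ++ agreements b
agreements (_ , t∨₁ a) = agreements a
agreements (_ , t∨₂ b) = agreements b
agreements (_ , t∨₃ a b _) = agreements a ++ agreements b
agreements (_ , t¬ a) = agreements a
agreements (_ , m∧₁ a b) = agreements a ++ agreements b
agreements (_ , m∧₂ a b) = agreements a ++ agreements b
agreements (_ , m∧₃ a b _) = (anchor a , anchor b) ∷ agreements a ++ agreements b
agreements (_ , m∨₁ a b) = agreements a ++ agreements b
agreements (_ , m∨₂ a b) = agreements a ++ agreements b
agreements (_ , m∨₃ a b _) = (anchor a , anchor b) ∷ agreements a ++ agreements b
agreements (_ , m¬ a) = agreements a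
agreements (_ , f∧₁ a) = agreements a
agreements (_ , f∧₂ b) = agreements b
agreements (_ , f∧₃ a b _) = agreements a ++ agreements b
agreements (_ , f∨ a b) = agreements a ++ agreements b
agreements (_ , f¬ a) = agreements a

agreements-derivable : (d : Expanded B M ψ) → All (VarSimilar B) (agreements d)
agreements-derivable (_ , atom) = []
agreements-derivable (_ , t∧ a b) = ++⁺ (agreements-derivable a) (agreements-derivable b)
agreements-derivable (_ , t∨₁ a) = agreements-derivable a
agreements-derivable (_ , t∨₂ b) = agreements-derivable b
agreements-derivable (_ , t∨₃ a b _) = ++⁺ (agreements-derivable a) (agreements-derivable b)
agreements-derivable (_ , t¬ a) = agreements-derivable a
agreements-derivable (_ , m∧₁ a b) = ++⁺ (agreements-derivable a) (agreements-derivable b)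
agreements-derivable (_ , m∧₂ a b) = ++⁺ (agreements-derivable a) (agreements-derivable b)
agreements-derivable (_ , m∧₃ a b r) =
  similar-anchors (∈⇒derivable r) a b ∷ ++⁺ (agreements-derivable a) (agreements-derivable b)
agreements-derivable (_ , m∨₁ a b) = ++⁺ (agreements-derivable a) (agreements-derivable b)
agreements-derivable (_ , m∨₂ a b) = ++⁺ (agreements-derivable a) (agreements-derivable b)
agreements-derivable (_ , m∨₃ a b r) =
  similar-anchors (∈⇒derivable r) a b ∷ ++⁺ (agreements-derivable a) (agreements-derivable b)
agreements-derivable (_ , m¬ a) = agreements-derivable a
agreements-derivable (_ , f∧₁ a) = agreements-derivable a
agreements-derivable (_ , f∧₂ b) = agreements-derivable b
agreements-derivable (_ , f∧₃ a b _) = ++⁺ (agreements-derivable a) (agreements-derivable b)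
agreements-derivable (_ , f∨ a b) = ++⁺ (agreements-derivable a) (agreements-derivable b)
agreements-derivable (_ , f¬ a) = agreements-derivable a

apart-along : ∀ {S} → All (VarSimilar B) S →
  Derivable B (var p ≁ var q) → EqClosure (Edge S) q k → Derivable B (var p ≁ var k)
apart-along _ d ε = d
apart-along sims d (fwd e ◅ path) = apart-along sims (derive₂ (≁trans _ _ _) d (All.lookup sims e)) path
apart-along sims d (bwd e ◅ path) =
  apart-along sims (derive₂ (≁trans _ _ _) d (derive₁ (∼sym _ _) (All.lookup sims e))) path

-- The countermodel

_≟ᴸ_ : DecidableEquality Label
𝔱 ≟ᴸ 𝔱 = yes refl
𝔪 ≟ᴸ 𝔪 = yes refl
𝔣 ≟ᴸ 𝔣 = yes refl
𝔱 ≟ᴸ 𝔪 = no λ ()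
𝔱 ≟ᴸ 𝔣 = no λ ()
𝔪 ≟ᴸ 𝔱 = no λ ()
𝔪 ≟ᴸ 𝔣 = no λ ()
𝔣 ≟ᴸ 𝔱 = no λ ()
𝔣 ≟ᴸ 𝔪 = no λ ()

nodeLabel : ℕ → Node → Maybe Label
nodeLabel p (lab M (var q)) with p ≟ q
... | yes _ = just M
... | no _ = nothing
nodeLabel _ _ = nothing

nodeLabel-self : ∀ p M → nodeLabel p (lab M (var p)) ≡ just M
nodeLabel-self p M with p ≟ p
... | yes _ = refl
... | no p≢p = ⊥-elim (p≢p refl)

nodeLabel-just : ∀ n → nodeLabel p n ≡ just M → n ≡ lab M (var p)
nodeLabel-just {p} (lab _ (var q)) e with p ≟ q
nodeLabel-just (lab _ (var _)) refl | yes refl = refl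
nodeLabel-just (lab _ (var _)) () | no _
nodeLabel-just (lab _ (¬' _)) ()
nodeLabel-just (lab _ (_ ∧' _)) ()
nodeLabel-just (lab _ (_ ∨' _)) ()
nodeLabel-just (_ ∼ _) ()
nodeLabel-just (_ ≁ _) ()

labelOn : List Node → ℕ → Maybe Label
labelOn [] _ = nothing
labelOn (n ∷ B) p = nodeLabel p n <∣> labelOn B p

labelOn-∈ : lab M (var p) ∈ B → ∃[ M′ ] labelOn B p ≡ just M′ × lab M′ (var p) ∈ B
labelOn-∈ {M} {p} (here refl) rewrite nodeLabel-self p M = M , refl , here refl
labelOn-∈ {p = p} {B = n ∷ _} (there m) with nodeLabel p n in eq
... | just M′ = M′ , refl , here (sym (nodeLabel-just n eq))
... | nothing = let M′ , first , m′ = labelOn-∈ m in M′ , first , there m′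

module Countermodel (B : List Node) (S : List (ℕ × ℕ)) (sims : All (VarSimilar B) S) where

  class : ℕ → ℕ
  class = classOf S

  value : ℕ → Label → Mω
  value _ 𝔱 = ⊤ᴹ
  value p 𝔪 = mid (class p)
  value _ 𝔣 = ⊥ᴹ

  -- The default ⊤ᴹ is arbitrary: unlabelled variables do not occur in the expansions.
  valuation : Valuation
  valuation p = maybe (value p) ⊤ᴹ (labelOn B p)

  target : Expanded B M ψ → Mω
  target {𝔱} _ = ⊤ᴹ
  target {𝔪} d = mid (class (anchor d))
  target {𝔣} _ = ⊥ᴹ

  target-atom : ∀ M (m : lab M (var p) ∈ B) → value p M ≡ target (m , atom)
  target-atom 𝔱 _ = refl
  target-atom 𝔪 _ = refl
  target-atom 𝔣 _ = refl

  target≢⊤ᴹ : M ≢ 𝔱 → (d : Expanded B M ψ) → target d ≢ ⊤ᴹ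
  target≢⊤ᴹ {𝔱} M≢𝔱 _ = ⊥-elim (M≢𝔱 refl)
  target≢⊤ᴹ {𝔪} _ _ ()
  target≢⊤ᴹ {𝔣} _ _ ()

  Agrees : ℕ × ℕ → Set
  Agrees (p , q) = class p ≡ class q

  anchors-apart : (φ ≁ χ) ∈ B → (a : Expanded B 𝔪 φ) (b : Expanded B 𝔪 χ) →
    Closable B ⊎ class (anchor a) ≢ class (anchor b)
  anchors-apart r a b with class (anchor a) ≟ class (anchor b)
  ... | no apart = inj₂ apart
  ... | yes same = inj₁ (self-apart-closes
    (apart-along sims (apart-anchors (∈⇒derivable r) a b) (classOf-connected S (sym same))))

  mutual
    evaluate : (d : Expanded B M ψ) → All Agrees (agreements d) → Closable B ⊎ ⟦ ψ ⟧ valuation ≡ target d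
    evaluate {M} {var p} (m , atom) _ with labelOn-∈ m
    ... | M′ , first , m′ with M ≟ᴸ M′
    ...   | yes refl = inj₂ (trans (cong (maybe (value p) ⊤ᴹ) first) (target-atom M m))
    ...   | no M≢M′ = inj₁ (done (clash M≢M′ m m′))
    evaluate (_ , t∧ a b) H = map₂ (uncurry (cong₂ _⊓_)) (evaluate₂ a b H)
    evaluate (_ , t∨₁ a) H = map₂ (cong (_⊔ _)) (evaluate a H)
    evaluate {ψ = φ ∨' _} (_ , t∨₂ b) H =
      map₂ (λ e → trans (cong (⟦ φ ⟧ valuation ⊔_) e) (⊔-zeroʳ (⟦ φ ⟧ valuation))) (evaluate b H)
    evaluate (_ , t∨₃ a b r) H with anchors-apart r a b
    ... | inj₁ closed = inj₁ closed
    ... | inj₂ apart =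
      map₂ (λ (e₁ , e₂) → trans (cong₂ _⊔_ e₁ e₂) (mid⊔mid-apart apart)) (evaluate₂ a b H)
    evaluate (_ , t¬ a) H = map₂ (cong negᴹ) (evaluate a H)
    evaluate (_ , m∧₁ a b) H = map₂ (uncurry (cong₂ _⊓_)) (evaluate₂ a b H)
    evaluate (_ , m∧₂ a b) H = map₂ (uncurry (cong₂ _⊓_)) (evaluate₂ a b H)
    evaluate (_ , m∧₃ a b _) (agree ∷ H) =
      map₂ (λ (e₁ , e₂) → trans (cong₂ _⊓_ e₁ e₂) (mid⊓mid-same agree)) (evaluate₂ a b H)
    evaluate (_ , m∨₁ a b) H = map₂ (uncurry (cong₂ _⊔_)) (evaluate₂ a b H)
    evaluate (_ , m∨₂ a b) H = map₂ (uncurry (cong₂ _⊔_)) (evaluate₂ a b H)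
    evaluate (_ , m∨₃ a b _) (agree ∷ H) =
      map₂ (λ (e₁ , e₂) → trans (cong₂ _⊔_ e₁ e₂) (mid⊔mid-same agree)) (evaluate₂ a b H)
    evaluate (_ , m¬ a) H = map₂ (cong negᴹ) (evaluate a H)
    evaluate (_ , f∧₁ a) H = map₂ (cong (_⊓ _)) (evaluate a H)
    evaluate {ψ = φ ∧' _} (_ , f∧₂ b) H =
      map₂ (λ e → trans (cong (⟦ φ ⟧ valuation ⊓_) e) (⊓-zeroʳ (⟦ φ ⟧ valuation))) (evaluate b H)
    evaluate (_ , f∧₃ a b r) H with anchors-apart r a b
    ... | inj₁ closed = inj₁ closed
    ... | inj₂ apart =
      map₂ (λ (e₁ , e₂) → trans (cong₂ _⊓_ e₁ e₂) (mid⊓mid-apart apart)) (evaluate₂ a b H)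
    evaluate (_ , f∨ a b) H = map₂ (uncurry (cong₂ _⊔_)) (evaluate₂ a b H)
    evaluate (_ , f¬ a) H = map₂ (cong negᴹ) (evaluate a H)

    evaluate₂ : (a : Expanded B M₁ φ) (b : Expanded B M₂ χ) →
      All Agrees (agreements a ++ agreements b) →
      Closable B ⊎ (⟦ φ ⟧ valuation ≡ target a × ⟦ χ ⟧ valuation ≡ target b)
    evaluate₂ a b H with ++⁻ (agreements a) H
    ... | Ha , Hb with evaluate a Ha | evaluate b Hb
    ...   | inj₁ closed | _ = inj₁ closed
    ...   | inj₂ _ | inj₁ closed = inj₁ closed
    ...   | inj₂ e₁ | inj₂ e₂ = inj₂ (e₁ , e₂)

expansions-close : φ ⊨ χ → M ≢ 𝔱 → Expanded B 𝔱 φ → Expanded B M χ → Closable B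
expansions-close {φ = φ} {χ = χ} {B = B} φ⊨χ M≢𝔱 a b =
  conclude (evaluate a (proj₁ agree)) (evaluate b (proj₂ agree))
  where
  S : List (ℕ × ℕ)
  S = agreements a ++ agreements b
  open Countermodel B S (++⁺ (agreements-derivable a) (agreements-derivable b))
  agree : All Agrees (agreements a) × All Agrees (agreements b)
  agree = ++⁻ (agreements a) (classOf-respects S)
  conclude : Closable B ⊎ ⟦ φ ⟧ valuation ≡ ⊤ᴹ → Closable B ⊎ ⟦ χ ⟧ valuation ≡ target b → Closable B
  conclude (inj₁ closed) _ = closed
  conclude (inj₂ _) (inj₁ closed) = closed
  conclude (inj₂ φ-true) (inj₂ χ-value) =
    ⊥-elim (target≢⊤ᴹ M≢𝔱 b (trans (sym χ-value) (φ⊨χ valuation φ-true)))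

completeness : φ ⊨ χ → M ≢ 𝔱 → Closable (lab 𝔱 φ ∷ lab M χ ∷ [])
completeness φ⊨χ M≢𝔱 = expand₂ {B = []} [] λ _ _ a b → expansions-close φ⊨χ M≢𝔱 a b

theorem7 : ∀ (φ χ : Fm) → (φ ⊨ χ → φ ⊢ χ) × (φ ⊢ χ → φ ⊨ χ)
theorem7 φ χ = (λ φ⊨χ → completeness φ⊨χ (λ ()) , completeness φ⊨χ (λ ())) , soundness
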